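{- Consider the following algorithm for the $k$-range-medians problem on an array $S[1..n]$ with (not necessarily disjoint) query intervals $I_1,\ldots,I_k$: break $S$ into at most $2k-1$ disjoint consecutive atomic intervals $B_1,\ldots,B_m$ such that no atomic interval contains an endpoint of any $I_i$ in its interior; sort each $B_i$; build a balanced binary tree with leaves $B_1,\ldots,B_m$ in this order, where bottom-up each node stores the sorted array of all elements in its subtree (obtained by merging its children's arrays); to answer $I_j$, take the $O(\log k)$ tree nodes whose subtrees exactly cover $I_j$ and compute the median of the union of their sorted arrays by a deterministic algorithm that finds the median of the union of $\ell$ sorted arrays of total size $N$ with $O(\ell\log(N/\ell))$ comparisons. This algorithm uses $O(n\log n + k\log n\log k)$ comparisons.
   Context: The $k$-range-medians problem: given an unsorted array $S[1..n]$ of distinct elements from a totally ordered set and $k$ intervals of positions $[l_j,r_j]$, output for each $j$ the median (element of rank $\lceil (r_j-l_j+1)/2\rceil$) of $\{S[l_j],\ldots,S[r_j]\}$. Complexity is measured by number of comparisons. -}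

module Defs where

open import Data.Nat using (ℕ; zero; suc; _+_; _*_; _∸_; _≤ᵇ_; _<ᵇ_; _⊔_)
open import Data.Nat.DivMod using (_/_)
open import Data.Nat.Logarithm using (⌊log₂_⌋)
open import Data.Bool using (Bool; true; false; if_then_else_; _∧_; _∨_)
open import Data.List using (List; []; _∷_; _++_; take; drop; length; map; sum)
open import Data.Product using (_×_; _,_; proj₁; proj₂)
open import Relation.Binary.PropositionalEquality using (_≡_)
open import Relation.Binary.Structures using (IsStrictTotalOrder)
open import Relation.Nullary using (does)

-- Comparison-based computations (decision trees).
-- A computation either returns a value, or asks the oracle whether
-- x < y holds and continues depending on the (Boolean) answer.

data Cmp (A B : Set) : Set where
  ret : B → Cmp A B
  ask : A → A → (Bool → Cmp A B) → Cmp A B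

_>>=_ : ∀ {A B C : Set} → Cmp A B → (B → Cmp A C) → Cmp A C
ret b       >>= f = f b
ask x y k   >>= f = ask x y (λ b → k b >>= f)

mapM : ∀ {A B C : Set} → (B → Cmp A C) → List B → Cmp A (List C)
mapM f []       = ret []
mapM f (x ∷ xs) = f x >>= λ y → mapM f xs >>= λ ys → ret (y ∷ ys)

module Run {A : Set} {_<_ : A → A → Set} (sto : IsStrictTotalOrder _≡_ _<_) where
  open IsStrictTotalOrder sto using (_<?_)

  run : ∀ {B : Set} → Cmp A B → B
  run (ret b)     = b
  run (ask x y k) = run (k (does (x <? y)))

  cost : ∀ {B : Set} → Cmp A B → ℕ
  cost (ret b)     = 0
  cost (ask x y k) = suc (cost (k (does (x <? y))))

merge : ∀ {A : Set} → List A → List A → Cmp A (List A)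
merge []       ys       = ret ys
merge (x ∷ xs) []       = ret (x ∷ xs)
merge (x ∷ xs) (y ∷ ys) =
  ask x y (λ b → if b then (merge xs (y ∷ ys) >>= λ zs → ret (x ∷ zs))
                      else (merge (x ∷ xs) ys >>= λ zs → ret (y ∷ zs)))

-- Logarithm convention: L x = 1 + ⌊log₂ x⌋  (≥ 1, as usual in O-bounds).

L : ℕ → ℕ
L x = suc ⌊log₂ x ⌋

medBound : ℕ → ℕ → ℕ
medBound zero    N = 0
medBound (suc l) N = suc l * L (N / suc l)

-- Positions are 1-based; an interval is a pair (l , r), meaning [l, r].

Interval : Set
Interval = ℕ × ℕ

-- S[a..b] (1-based, inclusive)
slice : ∀ {A : Set} → List A → Interval → List A
slice S (a , b) = take (suc b ∸ a) (drop (a ∸ 1) S)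

-- Atomic intervals from strictly increasing cut points p₀ < p₁ < … < pₘ:
-- B_i = [p_{i-1}, p_i - 1].
blocks : List ℕ → List Interval
blocks []            = []
blocks (a ∷ [])      = []
blocks (a ∷ b ∷ ps)  = (a , b ∸ 1) ∷ blocks (b ∷ ps)

data BT (X : Set) : Set where
  leaf : X → BT X
  node : BT X → BT X → BT X

leaves : ∀ {X : Set} → BT X → List X
leaves (leaf x)   = x ∷ []
leaves (node l r) = leaves l ++ leaves r

height : ∀ {X : Set} → BT X → ℕ
height (leaf x)   = 0
height (node l r) = suc (height l ⊔ height r)

data AT (A : Set) : Set where
  aleaf : Interval → List A → AT A
  anode : AT A → AT A → List A → AT A

range : ∀ {A : Set} → AT A → Interval
range (aleaf i xs)   = i
range (anode l r xs) = proj₁ (range l) , proj₂ (range r)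

arr : ∀ {A : Set} → AT A → List A
arr (aleaf i xs)   = xs
arr (anode l r xs) = xs

build : ∀ {A : Set} → (List A → Cmp A (List A)) → List A → BT Interval → Cmp A (AT A)
build sort S (leaf i)   = sort (slice S i) >>= λ ys → ret (aleaf i ys)
build sort S (node l r) =
  build sort S l >>= λ tl →
  build sort S r >>= λ tr →
  merge (arr tl) (arr tr) >>= λ zs →
  ret (anode tl tr zs)

contained : Interval → Interval → Bool
contained (a , b) (l , r) = (l ≤ᵇ a) ∧ (b ≤ᵇ r)

disjoint : Interval → Interval → Bool
disjoint (a , b) (l , r) = (b <ᵇ l) ∨ (r <ᵇ a)

cover : ∀ {A : Set} → AT A → Interval → List (List A)
cover t q with contained (range t) q
... | true  = arr t ∷ []
... | false with disjoint (range t) q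
...   | true  = []
...   | false with t
...     | aleaf i xs   = []
...     | anode l r xs = cover l q ++ cover r q

algorithm : ∀ {A : Set} → (List A → Cmp A (List A)) → (List (List A) → Cmp A A) →
            List A → BT Interval → List Interval → Cmp A (List A)
algorithm sort med S t qs =
  build sort S t >>= λ T → mapM (λ q → med (cover T q)) qs

module Submission where

open import Defs
open import Data.Bool using (true; false) renaming (T to True)
open import Data.Bool.Properties using (T-∧; T-∨)
open import Data.List using (List; []; _∷_; _++_; length; map; concat; take; drop)
import Data.List.Properties as List
open import Data.List.Membership.Propositional using (_∈_)
open import Data.List.Relation.Unary.All using (All; []; _∷_)
import Data.List.Relation.Unary.All as All
import Data.List.Relation.Unary.All.Properties as All
open import Data.List.Relation.Unary.AllPairs using ([]; _∷_)
open import Data.List.Relation.Unary.Linked using (Linked; _∷_)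
open import Data.List.Relation.Unary.Unique.Propositional using (Unique)
import Data.List.Relation.Unary.Unique.Propositional.Properties as Unique
open import Data.List.Relation.Binary.Permutation.Propositional
  using (_↭_; ↭-refl; ↭-sym; ↭-trans; ↭-reflexive; prep; ↭⇒↭ₛ; module PermutationReasoning)
open import Data.List.Relation.Binary.Permutation.Propositional.Properties
  using (shift; shifts; ++⁺; ++⁺ˡ; ↭-length)
import Data.List.Relation.Binary.Permutation.Setoid.Properties as Permutation
open import Data.Nat using (ℕ; zero; suc; _+_; _*_; _∸_; _^_; _≤_; _<_; _⊔_; _⊓_; s≤s; z≤n)
open import Data.Nat.Properties
open import Data.Nat.DivMod using (m/n≤m)
open import Data.Nat.ListAction using (sum)
open import Data.Nat.Logarithm
  using (⌊log₂_⌋; ⌈log₂_⌉; ⌊log₂⌋-mono-≤; ⌈log₂⌉-mono-≤; ⌊log₂[2^n]⌋≡n; ⌈log₂2^n⌉≡n)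
open import Data.Nat.Tactic.RingSolver using (solve-∀)
open import Data.Product using (_×_; _,_; proj₁; proj₂; ∃-syntax)
open import Data.Sum using (inj₁; inj₂)
open import Function using (Equivalence; _∘_)
open import Relation.Binary.PropositionalEquality
open import Relation.Binary.Structures using (IsStrictTotalOrder)
open import Relation.Binary.Definitions using (tri<; tri≈; tri>)
open import Relation.Nullary using (¬_; Dec; yes; no; does; contradiction)
open import Relation.Nullary.Decidable using (dec-true; dec-false)

-- Building the tree costs the sorting of the blocks, at most c₁ · n · L n, plus at most n comparisons
-- per level for the merges, since the arrays merged on one level are disjoint parts of S; the height
-- is ⌈log₂ m⌉ ≤ 1 + L k because m ≤ 2k − 1. A query interval is covered by at most two tree nodes
-- per level (one on each of the two root-to-leaf paths through its endpoints), so the median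
-- subroutine sees O(L k) sorted arrays of total size ≤ n and costs O(L k · L n) comparisons.

L-mono-≤ : ∀ {m n} → m ≤ n → L m ≤ L n
L-mono-≤ m≤n = s≤s (⌊log₂⌋-mono-≤ m≤n)

n<2^L[n] : ∀ n → n < 2 ^ L n
n<2^L[n] n = ≰⇒> λ 2^Ln≤n →
  1+n≰n (subst (_≤ ⌊log₂ n ⌋) (⌊log₂[2^n]⌋≡n (L n)) (⌊log₂⌋-mono-≤ 2^Ln≤n))

⌈log₂⌉≤1+L : ∀ {m} k → m ≤ 2 * k ∸ 1 → ⌈log₂ m ⌉ ≤ suc (L k)
⌈log₂⌉≤1+L {m} k m≤2k-1 = begin
  ⌈log₂ m ⌉               ≤⟨ ⌈log₂⌉-mono-≤ m≤2^[1+Lk] ⟩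
  ⌈log₂ 2 ^ suc (L k) ⌉   ≡⟨ ⌈log₂2^n⌉≡n (suc (L k)) ⟩
  suc (L k)               ∎
  where
  open ≤-Reasoning
  m≤2^[1+Lk] : m ≤ 2 ^ suc (L k)
  m≤2^[1+Lk] = ≤-trans m≤2k-1 (≤-trans (m∸n≤m (2 * k) 1) (*-monoʳ-≤ 2 (<⇒≤ (n<2^L[n] k))))

medBound≤ : ∀ l {N n} → N ≤ n → medBound l N ≤ l * L n
medBound≤ zero    _   = z≤n
medBound≤ (suc l) {N} N≤n = *-monoʳ-≤ (suc l) (L-mono-≤ (≤-trans (m/n≤m N (suc l)) N≤n))

2*[1+L]+2≤6*L : ∀ k → 2 * suc (L k) + 2 ≤ 6 * L k
2*[1+L]+2≤6*L k = ≤-trans (m≤m+n _ (4 * ⌊log₂ k ⌋)) (≤-reflexive (regroup ⌊log₂ k ⌋))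
  where
  regroup : ∀ j → 2 * suc (suc j) + 2 + 4 * j ≡ 6 * suc j
  regroup = solve-∀

L[k]*n≤ : ∀ n k → L k * n ≤ n * L n + k * L n * L k
L[k]*n≤ n k with k ≤? n
... | yes k≤n = begin
  L k * n      ≤⟨ *-monoˡ-≤ n (L-mono-≤ k≤n) ⟩
  L n * n      ≡⟨ *-comm (L n) n ⟩
  n * L n      ≤⟨ m≤m+n _ _ ⟩
  n * L n + k * L n * L k ∎
  where open ≤-Reasoning
... | no k≰n = begin
  L k * n          ≤⟨ *-monoʳ-≤ (L k) (<⇒≤ (≰⇒> k≰n)) ⟩
  L k * k          ≤⟨ m≤m*n (L k * k) (L n) ⟩
  L k * k * L n    ≡⟨ reorder (L k) k (L n) ⟩
  k * L n * L k    ≤⟨ m≤n+m _ _ ⟩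
  n * L n + k * L n * L k ∎
  where
  open ≤-Reasoning
  reorder : ∀ a b c → a * b * c ≡ b * c * a
  reorder = solve-∀

build+queries≤ : ∀ c₁ c₂ n k →
  c₁ * (n * L n) + suc (L k) * n + k * (c₂ * (6 * L k * L n))
    ≤ (c₁ + 2 + 6 * c₂) * (n * L n + k * L n * L k)
build+queries≤ c₁ c₂ n k = begin
  c₁ * (n * L n) + suc (L k) * n + k * (c₂ * (6 * L k * L n))
    ≡⟨ regroup c₁ c₂ n k (L n) (L k) ⟩
  c₁ * (n * L n) + (n + L k * n) + 6 * c₂ * (k * L n * L k)
    ≤⟨ +-mono-≤ (+-mono-≤ (*-monoʳ-≤ c₁ (m≤m+n _ _)) (+-mono-≤ n≤W (L[k]*n≤ n k)))
                (*-monoʳ-≤ (6 * c₂) (m≤n+m _ _)) ⟩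
  c₁ * W + (W + W) + 6 * c₂ * W
    ≡⟨ collect c₁ c₂ W ⟩
  (c₁ + 2 + 6 * c₂) * W ∎
  where
  open ≤-Reasoning
  W = n * L n + k * L n * L k
  n≤W : n ≤ W
  n≤W = ≤-trans (m≤m*n n (L n)) (m≤m+n _ _)
  regroup : ∀ c₁ c₂ n k a b → c₁ * (n * a) + suc b * n + k * (c₂ * (6 * b * a))
                            ≡ c₁ * (n * a) + (n + b * n) + 6 * c₂ * (k * a * b)
  regroup = solve-∀
  collect : ∀ c₁ c₂ w → c₁ * w + (w + w) + 6 * c₂ * w ≡ (c₁ + 2 + 6 * c₂) * w
  collect = solve-∀

build-cost-step : ∀ c l a b hₗ hᵣ {x y z} →
  x ≤ c * (a * l) + hₗ * a → y ≤ c * (b * l) + hᵣ * b → z ≤ a + b →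
  x + y + z ≤ c * ((a + b) * l) + suc (hₗ ⊔ hᵣ) * (a + b)
build-cost-step c l a b hₗ hᵣ {x} {y} {z} x≤ y≤ z≤ = begin
  x + y + z
    ≤⟨ +-mono-≤ (+-mono-≤ x≤ y≤) z≤ ⟩
  c * (a * l) + hₗ * a + (c * (b * l) + hᵣ * b) + (a + b)
    ≤⟨ +-monoˡ-≤ (a + b) (+-mono-≤ (+-monoʳ-≤ (c * (a * l)) (*-monoˡ-≤ a (m≤m⊔n hₗ hᵣ)))
                                   (+-monoʳ-≤ (c * (b * l)) (*-monoˡ-≤ b (m≤n⊔m hₗ hᵣ)))) ⟩
  c * (a * l) + h * a + (c * (b * l) + h * b) + (a + b)
    ≡⟨ collect c l a b h ⟩
  c * ((a + b) * l) + suc h * (a + b) ∎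
  where
  open ≤-Reasoning
  h = hₗ ⊔ hᵣ
  collect : ∀ c l a b h → c * (a * l) + h * a + (c * (b * l) + h * b) + (a + b)
                        ≡ c * ((a + b) * l) + suc h * (a + b)
  collect = solve-∀

x≤1∧y≤1+n⇒x+y≤2+m⊔n : ∀ m n {x y} → x ≤ 1 → y ≤ suc n → x + y ≤ suc (suc (m ⊔ n))
x≤1∧y≤1+n⇒x+y≤2+m⊔n m n x≤1 y≤1+n = +-mono-≤ x≤1 (≤-trans y≤1+n (s≤s (m≤n⊔m m n)))

x≤1+m∧y≤1⇒x+y≤2+m⊔n : ∀ m n {x y} → x ≤ suc m → y ≤ 1 → x + y ≤ suc (suc (m ⊔ n))
x≤1+m∧y≤1⇒x+y≤2+m⊔n m n {x} {y} x≤1+m y≤1 = subst₂ _≤_ (+-comm y x) (cong (suc ∘ suc) (⊔-comm n m))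
  (x≤1∧y≤1+n⇒x+y≤2+m⊔n n m y≤1 x≤1+m)

x≤1∧y≤2n+2⇒x+y≤2[1+m⊔n]+2 : ∀ m n {x y} → x ≤ 1 → y ≤ 2 * n + 2 → x + y ≤ 2 * suc (m ⊔ n) + 2
x≤1∧y≤2n+2⇒x+y≤2[1+m⊔n]+2 m n {x} {y} x≤1 y≤2n+2 = begin
  x + y                   ≤⟨ +-mono-≤ x≤1 (≤-trans y≤2n+2 (+-monoˡ-≤ 2 (*-monoʳ-≤ 2 (m≤n⊔m m n)))) ⟩
  1 + (2 * (m ⊔ n) + 2)   ≤⟨ n≤1+n _ ⟩
  2 + (2 * (m ⊔ n) + 2)   ≡⟨ regroup (m ⊔ n) ⟩
  2 * suc (m ⊔ n) + 2     ∎
  where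
  open ≤-Reasoning
  regroup : ∀ h → 2 + (2 * h + 2) ≡ 2 * suc h + 2
  regroup = solve-∀

x≤2m+2∧y≤1⇒x+y≤2[1+m⊔n]+2 : ∀ m n {x y} → x ≤ 2 * m + 2 → y ≤ 1 → x + y ≤ 2 * suc (m ⊔ n) + 2
x≤2m+2∧y≤1⇒x+y≤2[1+m⊔n]+2 m n {x} {y} x≤2m+2 y≤1 =
  subst₂ _≤_ (+-comm y x) (cong (λ h → 2 * suc h + 2) (⊔-comm n m))
    (x≤1∧y≤2n+2⇒x+y≤2[1+m⊔n]+2 n m y≤1 x≤2m+2)

x≤1+m∧y≤1+n⇒x+y≤2[1+m⊔n]+2 : ∀ m n {x y} → x ≤ suc m → y ≤ suc n → x + y ≤ 2 * suc (m ⊔ n) + 2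
x≤1+m∧y≤1+n⇒x+y≤2[1+m⊔n]+2 m n {x} {y} x≤1+m y≤1+n = begin
  x + y                       ≤⟨ +-mono-≤ (≤-trans x≤1+m (s≤s (m≤m⊔n m n)))
                                          (≤-trans y≤1+n (s≤s (m≤n⊔m m n))) ⟩
  suc (m ⊔ n) + suc (m ⊔ n)   ≡⟨ cong (suc (m ⊔ n) +_) (sym (+-identityʳ (suc (m ⊔ n)))) ⟩
  2 * suc (m ⊔ n)             ≤⟨ m≤m+n _ 2 ⟩
  2 * suc (m ⊔ n) + 2         ∎
  where open ≤-Reasoning

length-concat : ∀ {A : Set} (xss : List (List A)) → length (concat xss) ≡ sum (map length xss)
length-concat []         = refl
length-concat (xs ∷ xss) = trans (List.length-++ xs) (cong (length xs +_) (length-concat xss))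

Unique-resp-↭ : ∀ {A : Set} {xs ys : List A} → xs ↭ ys → Unique xs → Unique ys
Unique-resp-↭ {A} xs↭ys = Permutation.Unique-resp-↭ (setoid A) (↭⇒↭ₛ xs↭ys)

Unique-++⁻ˡ : ∀ {A : Set} (xs : List A) {ys} → Unique (xs ++ ys) → Unique xs
Unique-++⁻ˡ []       _          = []
Unique-++⁻ˡ (x ∷ xs) (x∉ ∷ u) = All.++⁻ˡ xs x∉ ∷ Unique-++⁻ˡ xs u

Unique-++⁻ʳ : ∀ {A : Set} (xs : List A) {ys} → Unique (xs ++ ys) → Unique ys
Unique-++⁻ʳ []       u       = u
Unique-++⁻ʳ (x ∷ xs) (_ ∷ u) = Unique-++⁻ʳ xs u

Unique-++-∷⁻ : ∀ {A : Set} (xs : List A) {y ys} → Unique (xs ++ y ∷ ys) → Unique (xs ++ ys)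
Unique-++-∷⁻ xs {y} {ys} u = Unique-++⁻ʳ (y ∷ []) (Unique-resp-↭ (shift y xs ys) u)

length-slice≤ : ∀ {A : Set} (S : List A) i → length (slice S i) ≤ length S
length-slice≤ S (a , b) = begin
  length (take (suc b ∸ a) (drop (a ∸ 1) S)) ≡⟨ List.length-take (suc b ∸ a) _ ⟩
  (suc b ∸ a) ⊓ length (drop (a ∸ 1) S)      ≤⟨ m⊓n≤n _ _ ⟩
  length (drop (a ∸ 1) S)                     ≡⟨ List.length-drop (a ∸ 1) S ⟩
  length S ∸ (a ∸ 1)                          ≤⟨ m∸n≤m (length S) (a ∸ 1) ⟩
  length S                                    ∎
  where open ≤-Reasoning

blocks-prefix : ∀ {A : Set} (S : List A) {p ps} → Linked _<_ (p ∷ ps) → 1 ≤ p →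
  ∃[ rest ] concat (map (slice S) (blocks (p ∷ ps))) ++ rest ≡ drop (p ∸ 1) S
blocks-prefix S {p} {[]} _ _ = drop (p ∸ 1) S , refl
blocks-prefix S {suc p} {suc q ∷ ps} (s≤s p<q ∷ sorted) _
  with blocks-prefix S sorted (s≤s z≤n)
... | rest , eq = rest , (begin
  (front ++ concat (map (slice S) (blocks (suc q ∷ ps)))) ++ rest
    ≡⟨ List.++-assoc front _ rest ⟩
  front ++ (concat (map (slice S) (blocks (suc q ∷ ps))) ++ rest)
    ≡⟨ cong (front ++_) eq ⟩
  front ++ drop q S
    ≡⟨ cong (λ i → front ++ drop i S) (sym (m+[n∸m]≡n (<⇒≤ p<q))) ⟩
  front ++ drop (p + (q ∸ p)) S
    ≡⟨ cong (front ++_) (sym (List.drop-drop p (q ∸ p) S)) ⟩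
  front ++ drop (q ∸ p) (drop p S)
    ≡⟨ List.take++drop≡id (q ∸ p) (drop p S) ⟩
  drop p S ∎)
  where
  open ≡-Reasoning
  front = take (q ∸ p) (drop p S)

data Consecutive : List Interval → ℕ → ℕ → Set where
  [_]ᶜ : ∀ {a b} → a ≤ b → Consecutive ((a , b) ∷ []) a b
  _∷ᶜ_ : ∀ {a c b is} → a ≤ c → Consecutive is (suc c) b → Consecutive ((a , c) ∷ is) a b

consecutive-++⁻ : ∀ is js {a b} → 0 < length is → 0 < length js → Consecutive (is ++ js) a b →
  ∃[ c ] Consecutive is a c × Consecutive js (suc c) b
consecutive-++⁻ ((a , c) ∷ []) (_ ∷ _) _ _ (a≤c ∷ᶜ w) = c , [ a≤c ]ᶜ , w
consecutive-++⁻ ((a , c) ∷ i ∷ is) js _ 0<|js| (a≤c ∷ᶜ w)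
  with consecutive-++⁻ (i ∷ is) js (s≤s z≤n) 0<|js| w
... | d , wˡ , wʳ = d , a≤c ∷ᶜ wˡ , wʳ

blocks-consecutive : ∀ {p q ps} → Linked _<_ (p ∷ q ∷ ps) → ∃[ b ] Consecutive (blocks (p ∷ q ∷ ps)) p b
blocks-consecutive {q = suc q} {[]}     (s≤s p≤q ∷ _)      = q , [ p≤q ]ᶜ
blocks-consecutive {q = suc q} {_ ∷ _} (s≤s p≤q ∷ sorted) with blocks-consecutive sorted
... | b , w = b , p≤q ∷ᶜ w

leaves-nonempty : ∀ {X : Set} (t : BT X) → 0 < length (leaves t)
leaves-nonempty (leaf _)   = s≤s z≤n
leaves-nonempty (node l r) =
  ≤-trans (leaves-nonempty l) (≤-trans (m≤m+n _ _) (≤-reflexive (sym (List.length-++ (leaves l)))))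

module Analysis {A : Set} {_≺_ : A → A → Set} (sto : IsStrictTotalOrder _≡_ _≺_) where
  open Run sto
  open IsStrictTotalOrder sto using (compare) renaming (_<?_ to _≺?_)

  run->>= : ∀ {B C} (m : Cmp A B) (f : B → Cmp A C) → run (m >>= f) ≡ run (f (run m))
  run->>= (ret b)     f = refl
  run->>= (ask x y k) f = run->>= (k (does (x ≺? y))) f

  cost->>= : ∀ {B C} (m : Cmp A B) (f : B → Cmp A C) → cost (m >>= f) ≡ cost m + cost (f (run m))
  cost->>= (ret b)     f = refl
  cost->>= (ask x y k) f = cong suc (cost->>= (k (does (x ≺? y))) f)

  cost->>=-ret : ∀ {B C} (m : Cmp A B) (f : B → C) → cost (m >>= λ b → ret (f b)) ≡ cost m
  cost->>=-ret m f = trans (cost->>= m _) (+-identityʳ (cost m))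

  cost-mapM≤ : ∀ {B C} (f : B → Cmp A C) {K} → (∀ x → cost (f x) ≤ K) →
               ∀ xs → cost (mapM f xs) ≤ length xs * K
  cost-mapM≤ f f≤K []       = z≤n
  cost-mapM≤ f f≤K (x ∷ xs) = begin
    cost (f x >>= λ y → mapM f xs >>= λ ys → ret (y ∷ ys))
      ≡⟨ cost->>= (f x) _ ⟩
    cost (f x) + cost (mapM f xs >>= λ ys → ret (_ ∷ ys))
      ≡⟨ cong (cost (f x) +_) (cost->>=-ret (mapM f xs) _) ⟩
    cost (f x) + cost (mapM f xs)
      ≤⟨ +-mono-≤ (f≤K x) (cost-mapM≤ f f≤K xs) ⟩
    _ + length xs * _ ∎
    where open ≤-Reasoning

  -- Stating the unfolding through an equation m ≡ ask x y k lets the continuation k be read off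
  -- the constructor form of m instead of being inferred from the stuck term run m.
  answered : ∀ {B} (m : Cmp A B) {x y k b} → m ≡ ask x y k → does (x ≺? y) ≡ b →
             run m ≡ run (k b) × cost m ≡ suc (cost (k b))
  answered _ refl refl = refl , refl

  ⊀∧≢⇒≻ : ∀ {x y} → ¬ x ≺ y → x ≢ y → y ≺ x
  ⊀∧≢⇒≻ {x} {y} x⊀y x≢y with compare x y
  ... | tri< x≺y _ _ = contradiction x≺y x⊀y
  ... | tri≈ _ x≡y _ = contradiction x≡y x≢y
  ... | tri> _ _ y≺x = y≺x

  data Merge : List A → List A → List A → ℕ → Set where
    []ˡ   : ∀ {ys} → Merge [] ys ys 0
    []ʳ   : ∀ {x xs} → Merge (x ∷ xs) [] (x ∷ xs) 0
    takeˡ : ∀ {x xs y ys zs c} → x ≺ y →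
            Merge xs (y ∷ ys) zs c → Merge (x ∷ xs) (y ∷ ys) (x ∷ zs) (suc c)
    takeʳ : ∀ {x xs y ys zs c} → ¬ x ≺ y →
            Merge (x ∷ xs) ys zs c → Merge (x ∷ xs) (y ∷ ys) (y ∷ zs) (suc c)

  merge-spec : ∀ xs ys → Merge xs ys (run (merge xs ys)) (cost (merge xs ys))
  merge-spec []       ys       = []ˡ
  merge-spec (x ∷ xs) []       = []ʳ
  -- Both recursive calls are made here rather than inside step, so that termination is visible
  -- through the lexicographic order on the two lists.
  merge-spec (x ∷ xs) (y ∷ ys) = step (x ≺? y) (merge-spec xs (y ∷ ys)) (merge-spec (x ∷ xs) ys)
    where
    m = merge (x ∷ xs) (y ∷ ys)
    mˡ = merge xs (y ∷ ys)
    mʳ = merge (x ∷ xs) ys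
    step : Dec (x ≺ y) → Merge xs (y ∷ ys) (run mˡ) (cost mˡ) → Merge (x ∷ xs) ys (run mʳ) (cost mʳ) →
           Merge (x ∷ xs) (y ∷ ys) (run m) (cost m)
    step (yes x≺y) specˡ _ with answered m refl (dec-true (x ≺? y) x≺y)
    ... | run≡ , cost≡ = subst₂ (Merge (x ∷ xs) (y ∷ ys))
      (sym (trans run≡ (run->>= mˡ _))) (sym (trans cost≡ (cong suc (cost->>=-ret mˡ _)))) (takeˡ x≺y specˡ)
    step (no x⊀y) _ specʳ with answered m refl (dec-false (x ≺? y) x⊀y)
    ... | run≡ , cost≡ = subst₂ (Merge (x ∷ xs) (y ∷ ys))
      (sym (trans run≡ (run->>= mʳ _))) (sym (trans cost≡ (cong suc (cost->>=-ret mʳ _)))) (takeʳ x⊀y specʳ)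

  Merge⇒cost≤ : ∀ {xs ys zs c} → Merge xs ys zs c → c ≤ length xs + length ys
  Merge⇒cost≤ []ˡ = z≤n
  Merge⇒cost≤ []ʳ = z≤n
  Merge⇒cost≤ (takeˡ _ m) = s≤s (Merge⇒cost≤ m)
  Merge⇒cost≤ (takeʳ {xs = xs} {ys = ys} _ m) =
    s≤s (≤-trans (Merge⇒cost≤ m) (≤-reflexive (sym (+-suc (length xs) (length ys)))))

  Merge⇒↭ : ∀ {xs ys zs c} → Merge xs ys zs c → zs ↭ xs ++ ys
  Merge⇒↭ []ˡ = ↭-refl
  Merge⇒↭ ([]ʳ {x} {xs}) = ↭-reflexive (sym (List.++-identityʳ (x ∷ xs)))
  Merge⇒↭ (takeˡ {x} _ m) = prep x (Merge⇒↭ m)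
  Merge⇒↭ (takeʳ {x} {xs} {y} {ys} _ m) = ↭-trans (prep y (Merge⇒↭ m)) (↭-sym (shift y (x ∷ xs) ys))

  takeʳ-≻ : ∀ {x xs y ys} → ¬ x ≺ y → Unique (x ∷ xs ++ y ∷ ys) → y ≺ x
  takeʳ-≻ {xs = xs} x⊀y (x∉ ∷ _) = ⊀∧≢⇒≻ x⊀y (All.head (All.++⁻ʳ xs x∉))

  Merge⇒Linked-from : ∀ {z xs ys zs c} → Merge xs ys zs c → Unique (xs ++ ys) →
    Linked _≺_ (z ∷ xs) → Linked _≺_ (z ∷ ys) → Linked _≺_ (z ∷ zs)
  Merge⇒Linked-from []ˡ _ _ zys = zys
  Merge⇒Linked-from []ʳ _ zxs _ = zxs
  Merge⇒Linked-from (takeˡ x≺y m) (_ ∷ u) (z≺x ∷ xxs) (_ ∷ yys) =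
    z≺x ∷ Merge⇒Linked-from m u xxs (x≺y ∷ yys)
  Merge⇒Linked-from (takeʳ {xs = xs} x⊀y m) u (_ ∷ xxs) (z≺y ∷ yys) =
    z≺y ∷ Merge⇒Linked-from m (Unique-++-∷⁻ (_ ∷ xs) u) (takeʳ-≻ x⊀y u ∷ xxs) yys

  Merge⇒Linked : ∀ {xs ys zs c} → Merge xs ys zs c → Unique (xs ++ ys) →
    Linked _≺_ xs → Linked _≺_ ys → Linked _≺_ zs
  Merge⇒Linked []ˡ _ _ sys = sys
  Merge⇒Linked []ʳ _ sxs _ = sxs
  Merge⇒Linked (takeˡ x≺y m) (_ ∷ u) sxs sys = Merge⇒Linked-from m u sxs (x≺y ∷ sys)
  Merge⇒Linked (takeʳ {xs = xs} x⊀y m) u sxs sys =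
    Merge⇒Linked-from m (Unique-++-∷⁻ (_ ∷ xs) u) (takeʳ-≻ x⊀y u ∷ sxs) sys

  shape : AT A → BT Interval
  shape (aleaf i _)   = leaf i
  shape (anode l r _) = node (shape l) (shape r)

  depth : AT A → ℕ
  depth τ = height (shape τ)

  data SortedTree : AT A → Set where
    sorted-leaf : ∀ {i xs} → Linked _≺_ xs → SortedTree (aleaf i xs)
    sorted-node : ∀ {l r xs} → Linked _≺_ xs → xs ↭ arr l ++ arr r → SortedTree l → SortedTree r →
                  SortedTree (anode l r xs)

  arr-sorted : ∀ {τ} → SortedTree τ → Linked _≺_ (arr τ)
  arr-sorted (sorted-leaf s)       = s
  arr-sorted (sorted-node s _ _ _) = s

  data Spans : AT A → ℕ → ℕ → Set where
    span-leaf : ∀ {a b xs} → a ≤ b → Spans (aleaf (a , b) xs) a b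
    span-node : ∀ {l r xs a c b} → Spans l a c → Spans r (suc c) b → Spans (anode l r xs) a b

  consecutive⇒spans : ∀ τ {a b} → Consecutive (leaves (shape τ)) a b → Spans τ a b
  consecutive⇒spans (aleaf _ _) [ a≤b ]ᶜ = span-leaf a≤b
  consecutive⇒spans (anode l r _) w
    with consecutive-++⁻ (leaves (shape l)) (leaves (shape r)) (leaves-nonempty (shape l)) (leaves-nonempty (shape r)) w
  ... | _ , wˡ , wʳ = span-node (consecutive⇒spans l wˡ) (consecutive⇒spans r wʳ)

  spans-range : ∀ {τ a b} → Spans τ a b → range τ ≡ (a , b)
  spans-range (span-leaf _)     = refl
  spans-range (span-node wˡ wʳ) = cong₂ _,_ (cong proj₁ (spans-range wˡ)) (cong proj₂ (spans-range wʳ))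

  spans-≤ : ∀ {τ a b} → Spans τ a b → a ≤ b
  spans-≤ (span-leaf a≤b)   = a≤b
  spans-≤ (span-node wˡ wʳ) = ≤-trans (spans-≤ wˡ) (≤-trans (n≤1+n _) (spans-≤ wʳ))

  SortsWithin : (List A → Cmp A (List A)) → ℕ → Set
  SortsWithin sort c₁ = ∀ xs → Unique xs → Linked _≺_ (run (sort xs)) × (run (sort xs) ↭ xs)
                                          × (cost (sort xs) ≤ c₁ * (length xs * L (length xs)))

  MedianWithin : (List (List A) → Cmp A A) → ℕ → Set
  MedianWithin med c₂ = ∀ arrs → All (Linked _≺_) arrs → Unique (concat arrs) →
                        cost (med arrs) ≤ c₂ * medBound (length arrs) (sum (map length arrs))

  module Build (sort : List A → Cmp A (List A)) (c₁ : ℕ) (sort-spec : SortsWithin sort c₁) (S : List A) where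

    content : BT Interval → List A
    content t = concat (map (slice S) (leaves t))

    content-leaf : ∀ i → content (leaf i) ≡ slice S i
    content-leaf i = List.++-identityʳ (slice S i)

    content-node : ∀ l r → content (node l r) ≡ content l ++ content r
    content-node l r = trans (cong concat (List.map-++ (slice S) (leaves l) (leaves r)))
                             (sym (List.concat-++ (map (slice S) (leaves l)) (map (slice S) (leaves r))))

    content-prefix : ∀ t {p ps} → leaves t ≡ blocks (p ∷ ps) → Linked _<_ (p ∷ ps) → 1 ≤ p →
                     ∃[ rest ] content t ++ rest ≡ drop (p ∸ 1) S
    content-prefix t leaves≡ sorted 1≤p rewrite leaves≡ = blocks-prefix S sorted 1≤p

    content-within : ∀ t {p ps} → Unique S → leaves t ≡ blocks (p ∷ ps) → Linked _<_ (p ∷ ps) → 1 ≤ p →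
                     Unique (content t) × length (content t) ≤ length S
    content-within t {p} uS leaves≡ sorted 1≤p with content-prefix t leaves≡ sorted 1≤p
    ... | rest , content++rest≡ =
      Unique-++⁻ˡ (content t) (subst Unique (sym content++rest≡) (Unique.drop⁺ (p ∸ 1) uS)) , (begin
        length (content t)          ≤⟨ List.length-++-≤ˡ (content t) ⟩
        length (content t ++ rest)  ≡⟨ cong length content++rest≡ ⟩
        length (drop (p ∸ 1) S)     ≡⟨ List.length-drop (p ∸ 1) S ⟩
        length S ∸ (p ∸ 1)          ≤⟨ m∸n≤m (length S) (p ∸ 1) ⟩
        length S                    ∎)
      where open ≤-Reasoning

    built : BT Interval → AT A
    built t = run (build sort S t)

    merged : BT Interval → BT Interval → Cmp A (List A)
    merged l r = merge (arr (built l)) (arr (built r))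

    built-leaf : ∀ i → built (leaf i) ≡ aleaf i (run (sort (slice S i)))
    built-leaf i = run->>= (sort (slice S i)) _

    built-node : ∀ l r → built (node l r) ≡ anode (built l) (built r) (run (merged l r))
    built-node l r = trans (run->>= (build sort S l) _) (trans (run->>= (build sort S r) _) (run->>= (merged l r) _))

    cost-build-leaf : ∀ i → cost (build sort S (leaf i)) ≡ cost (sort (slice S i))
    cost-build-leaf i = cost->>=-ret (sort (slice S i)) _

    cost-build-node : ∀ l r → cost (build sort S (node l r)) ≡
                      cost (build sort S l) + cost (build sort S r) + cost (merged l r)
    cost-build-node l r = begin
      cost (build sort S (node l r))
        ≡⟨ cost->>= (build sort S l) _ ⟩
      cost (build sort S l) + cost (build sort S r >>= _)
        ≡⟨ cong (cost (build sort S l) +_) (cost->>= (build sort S r) _) ⟩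
      cost (build sort S l) + (cost (build sort S r) + cost (merged l r >>= _))
        ≡⟨ cong (λ c → cost (build sort S l) + (cost (build sort S r) + c)) (cost->>=-ret (merged l r) _) ⟩
      cost (build sort S l) + (cost (build sort S r) + cost (merged l r))
        ≡⟨ sym (+-assoc (cost (build sort S l)) _ _) ⟩
      cost (build sort S l) + cost (build sort S r) + cost (merged l r) ∎
      where open ≡-Reasoning

    shape-built : ∀ t → shape (built t) ≡ t
    shape-built (leaf i)   = cong shape (built-leaf i)
    shape-built (node l r) = trans (cong shape (built-node l r)) (cong₂ node (shape-built l) (shape-built r))

    depth-built : ∀ t → depth (built t) ≡ height t
    depth-built t = cong height (shape-built t)

    built-spans : ∀ t {p q ps} → leaves t ≡ blocks (p ∷ q ∷ ps) → Linked _<_ (p ∷ q ∷ ps) →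
                  ∃[ b ] Spans (built t) p b
    built-spans t leaves≡ sorted with blocks-consecutive sorted
    ... | b , w = b , consecutive⇒spans (built t)
                        (subst (λ is → Consecutive is _ b) (sym (trans (cong leaves (shape-built t)) leaves≡)) w)

    built-sorted : ∀ t → Unique (content t) → SortedTree (built t) × arr (built t) ↭ content t
    built-sorted (leaf i) u rewrite built-leaf i | content-leaf i =
      sorted-leaf (proj₁ (sort-spec (slice S i) u)) , proj₁ (proj₂ (sort-spec (slice S i) u))
    built-sorted (node l r) u rewrite built-node l r | content-node l r
      with built-sorted l (Unique-++⁻ˡ (content l) u) | built-sorted r (Unique-++⁻ʳ (content l) u)
    ... | sortedˡ , ↭ˡ | sortedʳ , ↭ʳ =
      sorted-node (Merge⇒Linked spec (Unique-resp-↭ (↭-sym arrs↭) u) (arr-sorted sortedˡ) (arr-sorted sortedʳ))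
                  (Merge⇒↭ spec) sortedˡ sortedʳ ,
      ↭-trans (Merge⇒↭ spec) arrs↭
      where
      spec = merge-spec (arr (built l)) (arr (built r))
      arrs↭ : arr (built l) ++ arr (built r) ↭ content l ++ content r
      arrs↭ = ++⁺ ↭ˡ ↭ʳ

    cost-build≤ : ∀ t → Unique (content t) →
      cost (build sort S t) ≤ c₁ * (length (content t) * L (length S)) + height t * length (content t)
    cost-build≤ (leaf i) u rewrite cost-build-leaf i | content-leaf i = begin
      cost (sort (slice S i))
        ≤⟨ proj₂ (proj₂ (sort-spec (slice S i) u)) ⟩
      c₁ * (length (slice S i) * L (length (slice S i)))
        ≤⟨ *-monoʳ-≤ c₁ (*-monoʳ-≤ (length (slice S i)) (L-mono-≤ (length-slice≤ S i))) ⟩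
      c₁ * (length (slice S i) * L (length S))
        ≡⟨ sym (+-identityʳ _) ⟩
      c₁ * (length (slice S i) * L (length S)) + 0 ∎
      where open ≤-Reasoning
    cost-build≤ (node l r) u rewrite cost-build-node l r | content-node l r | List.length-++ (content l) {content r} =
      build-cost-step c₁ (L (length S)) (length (content l)) (length (content r)) (height l) (height r)
        (cost-build≤ l uˡ) (cost-build≤ r uʳ)
        (subst₂ (λ a b → cost (merged l r) ≤ a + b)
                (↭-length (proj₂ (built-sorted l uˡ))) (↭-length (proj₂ (built-sorted r uʳ)))
                (Merge⇒cost≤ (merge-spec (arr (built l)) (arr (built r)))))
      where
      uˡ = Unique-++⁻ˡ (content l) u
      uʳ = Unique-++⁻ʳ (content l) u

  -- Indexed by the value of cover τ q, so that matching on cover-case τ q refines that value.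
  data CoverCase : AT A → Interval → List (List A) → Set where
    whole : ∀ {τ q} → CoverCase τ q (arr τ ∷ [])
    none  : ∀ {τ q} → CoverCase τ q []
    split : ∀ {l r xs q} → CoverCase (anode l r xs) q (cover l q ++ cover r q)

  cover-case : ∀ τ q → CoverCase τ q (cover τ q)
  cover-case τ q with contained (range τ) q
  ... | true = whole
  ... | false with disjoint (range τ) q
  ...   | true = none
  ...   | false with τ
  ...     | aleaf _ _   = none
  ...     | anode _ _ _ = split

  cover-sorted : ∀ {τ} q → SortedTree τ → All (Linked _≺_) (cover τ q)
  cover-sorted {τ} q s with cover τ q | cover-case τ q
  ... | _ | whole = arr-sorted s ∷ []
  ... | _ | none  = []
  cover-sorted q (sorted-node _ _ sˡ sʳ) | _ | split = All.++⁺ (cover-sorted q sˡ) (cover-sorted q sʳ)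

  cover-⊆ : ∀ {τ} q → SortedTree τ → ∃[ rest ] concat (cover τ q) ++ rest ↭ arr τ
  cover-⊆ {τ} q s with cover τ q | cover-case τ q
  ... | _ | whole = [] , ↭-reflexive (trans (List.++-identityʳ _) (List.++-identityʳ (arr τ)))
  ... | _ | none  = arr τ , ↭-refl
  cover-⊆ q (sorted-node {l} {r} {xs} _ xs↭ sˡ sʳ) | _ | split
    with cover-⊆ q sˡ | cover-⊆ q sʳ
  ... | restˡ , ↭ˡ | restʳ , ↭ʳ = restˡ ++ restʳ , (begin
    concat (cover l q ++ cover r q) ++ restˡ ++ restʳ
      ≡⟨ cong (_++ restˡ ++ restʳ) (sym (List.concat-++ (cover l q) (cover r q))) ⟩
    (cl ++ cr) ++ restˡ ++ restʳ
      ≡⟨ List.++-assoc cl cr _ ⟩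
    cl ++ cr ++ restˡ ++ restʳ
      ↭⟨ ++⁺ˡ cl (shifts cr restˡ) ⟩
    cl ++ restˡ ++ cr ++ restʳ
      ≡⟨ sym (List.++-assoc cl restˡ _) ⟩
    (cl ++ restˡ) ++ cr ++ restʳ
      ↭⟨ ++⁺ ↭ˡ ↭ʳ ⟩
    arr l ++ arr r
      ↭⟨ ↭-sym xs↭ ⟩
    xs ∎)
    where
    open PermutationReasoning
    cl = concat (cover l q)
    cr = concat (cover r q)

  length-cover-contained : ∀ (τ : AT A) q → True (contained (range τ) q) → length (cover τ q) ≤ 1
  length-cover-contained τ q h with contained (range τ) q
  ... | true = ≤-refl

  length-cover-disjoint : ∀ (τ : AT A) q → True (disjoint (range τ) q) → length (cover τ q) ≤ 1
  length-cover-disjoint τ q h with contained (range τ) q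
  ... | true = ≤-refl
  ... | false with disjoint (range τ) q
  ...   | true = z≤n

  length-cover-inside : ∀ {τ a b} ql qr → Spans τ a b → ql ≤ a → b ≤ qr → length (cover τ (ql , qr)) ≤ 1
  length-cover-inside {τ} ql qr w ql≤a b≤qr = length-cover-contained τ (ql , qr) inside
    where
    inside : True (contained (range τ) (ql , qr))
    inside rewrite spans-range w = Equivalence.from T-∧ (≤⇒≤ᵇ ql≤a , ≤⇒≤ᵇ b≤qr)

  length-cover-left-of : ∀ {τ a b} ql qr → Spans τ a b → b < ql → length (cover τ (ql , qr)) ≤ 1
  length-cover-left-of {τ} ql qr w b<ql = length-cover-disjoint τ (ql , qr) apart
    where
    apart : True (disjoint (range τ) (ql , qr))
    apart rewrite spans-range w = Equivalence.from T-∨ (inj₁ (<⇒<ᵇ b<ql))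

  length-cover-right-of : ∀ {τ a b} ql qr → Spans τ a b → qr < a → length (cover τ (ql , qr)) ≤ 1
  length-cover-right-of {τ} ql qr w qr<a = length-cover-disjoint τ (ql , qr) apart
    where
    apart : True (disjoint (range τ) (ql , qr))
    apart rewrite spans-range w = Equivalence.from T-∨ (inj₂ (<⇒<ᵇ qr<a))

  -- When the query reaches past the right end of τ, at each node either the right child is covered
  -- entirely or the left child is missed entirely, so only one path is followed; symmetrically on the
  -- left. A general query follows one path until it splits, then a suffix path and a prefix path.
  length-cover-suffix : ∀ {τ a b} ql qr → Spans τ a b → b ≤ qr → length (cover τ (ql , qr)) ≤ suc (depth τ)
  length-cover-suffix {τ} ql qr w b≤qr with cover τ (ql , qr) | cover-case τ (ql , qr)
  ... | _ | whole = s≤s z≤n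
  ... | _ | none  = z≤n
  length-cover-suffix ql qr (span-node {l} {r} {c = c} wˡ wʳ) b≤qr | _ | split
    rewrite List.length-++ (cover l (ql , qr)) {cover r (ql , qr)} with ql ≤? suc c
  ... | yes ql≤1+c = x≤1+m∧y≤1⇒x+y≤2+m⊔n (depth l) (depth r)
                       (length-cover-suffix ql qr wˡ c≤qr) (length-cover-inside ql qr wʳ ql≤1+c b≤qr)
    where c≤qr = ≤-trans (n≤1+n c) (≤-trans (spans-≤ wʳ) b≤qr)
  ... | no ql≰1+c = x≤1∧y≤1+n⇒x+y≤2+m⊔n (depth l) (depth r)
                      (length-cover-left-of ql qr wˡ (<-trans (n<1+n c) (≰⇒> ql≰1+c)))
                      (length-cover-suffix ql qr wʳ b≤qr)

  length-cover-prefix : ∀ {τ a b} ql qr → Spans τ a b → ql ≤ a → length (cover τ (ql , qr)) ≤ suc (depth τ)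
  length-cover-prefix {τ} ql qr w ql≤a with cover τ (ql , qr) | cover-case τ (ql , qr)
  ... | _ | whole = s≤s z≤n
  ... | _ | none  = z≤n
  length-cover-prefix ql qr (span-node {l} {r} {c = c} wˡ wʳ) ql≤a | _ | split
    rewrite List.length-++ (cover l (ql , qr)) {cover r (ql , qr)} with c ≤? qr
  ... | yes c≤qr = x≤1∧y≤1+n⇒x+y≤2+m⊔n (depth l) (depth r)
                     (length-cover-inside ql qr wˡ ql≤a c≤qr) (length-cover-prefix ql qr wʳ ql≤1+c)
    where ql≤1+c = ≤-trans ql≤a (≤-trans (spans-≤ wˡ) (n≤1+n c))
  ... | no c≰qr = x≤1+m∧y≤1⇒x+y≤2+m⊔n (depth l) (depth r)
                    (length-cover-prefix ql qr wˡ ql≤a)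
                    (length-cover-right-of ql qr wʳ (<-trans (≰⇒> c≰qr) (n<1+n c)))

  length-cover≤ : ∀ {τ a b} ql qr → Spans τ a b → length (cover τ (ql , qr)) ≤ 2 * depth τ + 2
  length-cover≤ {τ} ql qr w with cover τ (ql , qr) | cover-case τ (ql , qr)
  ... | _ | whole = ≤-trans (s≤s z≤n) (m≤n+m 2 _)
  ... | _ | none  = z≤n
  length-cover≤ ql qr (span-node {l} {r} {c = c} wˡ wʳ) | _ | split
    rewrite List.length-++ (cover l (ql , qr)) {cover r (ql , qr)} with qr ≤? c | ql ≤? c
  ... | yes qr≤c | _ = x≤2m+2∧y≤1⇒x+y≤2[1+m⊔n]+2 (depth l) (depth r)
                         (length-cover≤ ql qr wˡ) (length-cover-right-of ql qr wʳ (s≤s qr≤c))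
  ... | no qr≰c | yes ql≤c = x≤1+m∧y≤1+n⇒x+y≤2[1+m⊔n]+2 (depth l) (depth r)
                               (length-cover-suffix ql qr wˡ (<⇒≤ (≰⇒> qr≰c)))
                               (length-cover-prefix ql qr wʳ (m≤n⇒m≤1+n ql≤c))
  ... | no _ | no ql≰c = x≤1∧y≤2n+2⇒x+y≤2[1+m⊔n]+2 (depth l) (depth r)
                           (length-cover-left-of ql qr wˡ (≰⇒> ql≰c)) (length-cover≤ ql qr wʳ)

  module Algorithm (sort : List A → Cmp A (List A)) (c₁ : ℕ) (sort-spec : SortsWithin sort c₁)
                   (med : List (List A) → Cmp A A) (c₂ : ℕ) (med-spec : MedianWithin med c₂) where

    cost-query≤ : ∀ {τ a b n} q → SortedTree τ → Unique (arr τ) → length (arr τ) ≤ n → Spans τ a b →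
                  cost (med (cover τ q)) ≤ c₂ * ((2 * depth τ + 2) * L n)
    cost-query≤ {τ} {n = n} q@(ql , qr) sorted u size w with cover-⊆ q sorted
    ... | rest , arrs++rest↭ = begin
      cost (med arrs)
        ≤⟨ med-spec arrs (cover-sorted q sorted)
                    (Unique-++⁻ˡ (concat arrs) (Unique-resp-↭ (↭-sym arrs++rest↭) u)) ⟩
      c₂ * medBound (length arrs) (sum (map length arrs))
        ≤⟨ *-monoʳ-≤ c₂ (medBound≤ (length arrs) total≤n) ⟩
      c₂ * (length arrs * L n)
        ≤⟨ *-monoʳ-≤ c₂ (*-monoˡ-≤ (L n) (length-cover≤ ql qr w)) ⟩
      c₂ * ((2 * depth τ + 2) * L n) ∎
      where
      open ≤-Reasoning
      arrs = cover τ q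
      total≤n : sum (map length arrs) ≤ n
      total≤n = begin
        sum (map length arrs)         ≡⟨ length-concat arrs ⟨
        length (concat arrs)          ≤⟨ List.length-++-≤ˡ (concat arrs) ⟩
        length (concat arrs ++ rest)  ≡⟨ ↭-length arrs++rest↭ ⟩
        length (arr τ)                ≤⟨ size ⟩
        n                             ∎

    cost-algorithm≤ : ∀ S qs {p q ps} t → Unique S → Linked _<_ (p ∷ q ∷ ps) → 1 ≤ p →
      length (blocks (p ∷ q ∷ ps)) ≤ 2 * length qs ∸ 1 → leaves t ≡ blocks (p ∷ q ∷ ps) →
      height t ≤ ⌈log₂ length (blocks (p ∷ q ∷ ps)) ⌉ →
      cost (algorithm sort med S t qs)
        ≤ (c₁ + 2 + 6 * c₂) * (length S * L (length S) + length qs * L (length S) * L (length qs))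
    cost-algorithm≤ S qs t uS sorted 1≤p few-blocks leaves≡ height≤ = begin
      cost (algorithm sort med S t qs)
        ≡⟨ cost->>= (build sort S t) _ ⟩
      cost (build sort S t) + cost (mapM (λ q → med (cover τ q)) qs)
        ≤⟨ +-mono-≤ build≤ (cost-mapM≤ _ query≤ qs) ⟩
      c₁ * (n * L n) + suc (L k) * n + k * (c₂ * (6 * L k * L n))
        ≤⟨ build+queries≤ c₁ c₂ n k ⟩
      (c₁ + 2 + 6 * c₂) * (n * L n + k * L n * L k) ∎
      where
      open ≤-Reasoning
      open Build sort c₁ sort-spec S
      n = length S
      k = length qs
      τ = built t
      unique = proj₁ (content-within t uS leaves≡ sorted 1≤p)
      size = proj₂ (content-within t uS leaves≡ sorted 1≤p)
      sortedτ = built-sorted t unique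
      height≤1+Lk : height t ≤ suc (L k)
      height≤1+Lk = ≤-trans height≤ (⌈log₂⌉≤1+L k few-blocks)
      build≤ : cost (build sort S t) ≤ c₁ * (n * L n) + suc (L k) * n
      build≤ = ≤-trans (cost-build≤ t unique)
                       (+-mono-≤ (*-monoʳ-≤ c₁ (*-monoˡ-≤ (L n) size)) (*-mono-≤ height≤1+Lk size))
      depth≤ : 2 * depth τ + 2 ≤ 6 * L k
      depth≤ = ≤-trans (+-monoˡ-≤ 2 (*-monoʳ-≤ 2 (subst (_≤ suc (L k)) (sym (depth-built t)) height≤1+Lk)))
                       (2*[1+L]+2≤6*L k)
      query≤ : ∀ q → cost (med (cover τ q)) ≤ c₂ * (6 * L k * L n)
      query≤ q = ≤-trans
        (cost-query≤ q (proj₁ sortedτ) (Unique-resp-↭ (↭-sym (proj₂ sortedτ)) unique)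
                       (≤-trans (≤-reflexive (↭-length (proj₂ sortedτ))) size)
                       (proj₂ (built-spans t leaves≡ sorted)))
        (*-monoʳ-≤ c₂ (*-monoˡ-≤ (L n) depth≤))

lemma3p2 : {A : Set} {_≺_ : A → A → Set} (sto : IsStrictTotalOrder _≡_ _≺_) →
    (sort : List A → Cmp A (List A)) → (med : List (List A) → Cmp A A) →
    (c₁ : ℕ) →
    (∀ (xs : List A) → Unique xs →
       Linked _≺_ (Run.run sto (sort xs)) × (Run.run sto (sort xs) ↭ xs)
       × (Run.cost sto (sort xs) ≤ c₁ * (length xs * L (length xs)))) →
    (c₂ : ℕ) →
    (∀ (arrs : List (List A)) → All (Linked _≺_) arrs → Unique (concat arrs) →
       Run.cost sto (med arrs) ≤ c₂ * medBound (length arrs) (sum (map length arrs))) →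
    ∃[ c ] (∀ (S : List A) (qs : List Interval) (cuts : List ℕ) (t : BT Interval) →
      Unique S →
      All (λ q → 1 ≤ proj₁ q × proj₁ q ≤ proj₂ q × proj₂ q ≤ length S) qs →
      Linked _<_ cuts →
      All (λ p → 1 ≤ p × p ≤ suc (length S)) cuts →
      All (λ q → proj₁ q ∈ cuts × suc (proj₂ q) ∈ cuts) qs →
      length (blocks cuts) ≤ 2 * length qs ∸ 1 →
      leaves t ≡ blocks cuts →
      height t ≤ ⌈log₂ length (blocks cuts) ⌉ →
      Run.cost sto (algorithm sort med S t qs)
        ≤ c * (length S * L (length S) + length qs * L (length S) * L (length qs)))
lemma3p2 sto sort med c₁ sort-spec c₂ med-spec = c₁ + 2 + 6 * c₂ , λ where
    S qs []          t _  _ _      _                _ _          leaves≡ _       → no-leaves t leaves≡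
    S qs (_ ∷ [])    t _  _ _      _                _ _          leaves≡ _       → no-leaves t leaves≡
    S qs (_ ∷ _ ∷ _) t uS _ sorted ((1≤p , _) ∷ _) _ few-blocks leaves≡ height≤ →
      cost-algorithm≤ S qs t uS sorted 1≤p few-blocks leaves≡ height≤
  where
  open Analysis sto
  open Algorithm sort c₁ sort-spec med c₂ med-spec
  no-leaves : ∀ {X B : Set} (t : BT X) → leaves t ≡ [] → B
  no-leaves t leaves≡[] = contradiction (sym (cong length leaves≡[])) (<⇒≢ (leaves-nonempty t))
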